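{- Let $1\le m<n$ and $f=\sum_{\sigma\in\Delta}\sum_{r\bmod p^{n-1}}c_{r,\sigma}\,\sigma\,\gamma^r\in\mathcal{O}_E[G_n]$. For $\sigma\in\Delta$ and $r\in\mathbb{Z}/p^m\mathbb{Z}$ put $b_{r,\sigma}=\sum_{s\bmod p^{n-1},\ s\equiv r\bmod p^m}c_{s,\sigma}$. Then $\Phi_m(\gamma)$ divides $f$ in $\mathcal{O}_E[G_n]$ if and only if $b_{r,\sigma}=b_{s,\sigma}$ for all $\sigma\in\Delta$ and all $r,s$ with $r\equiv s\bmod p^{m-1}$.
   Context: $p$ is an odd prime, $E$ a finite extension of $\mathbb{Q}_p$ with ring of integers $\mathcal{O}_E$. $G_n=\mathrm{Gal}(\mathbb{Q}_p(\mu_{p^n})/\mathbb{Q}_p)$ for $n\ge1$; $G_\infty=\varprojlim G_n\cong\Delta\times\Gamma$ with $\Delta$ of order $p-1$ and $\Gamma\cong\mathbb{Z}_p$ with topological generator $\gamma$, so that $\mathcal{O}_E[G_n]\cong\mathcal{O}_E[\Delta][\gamma]/(\gamma^{p^{n-1}}-1)$. $\Phi_m$ is the $p^m$-th cyclotomic polynomial, $\Phi_m(\gamma)=\sum_{i=0}^{p-1}\gamma^{ip^{m-1}}$. -}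

module Defs where

open import Level using (Level)
open import Algebra.Bundles using (CommutativeRing)
open import Data.Nat using (ℕ; zero; suc; _+_; _*_; _∸_; _^_; ∣_-_∣)
open import Data.Nat.Divisibility using (_∣_; _∣?_)
open import Data.Fin using (Fin; toℕ)
import Data.Fin as F
open import Data.Product using (Σ-syntax)
open import Relation.Nullary using (Dec; yes; no)
open import Relation.Binary.PropositionalEquality using (_≡_)

infix 4 _≡_[mod_] _≡?_[mod_]
_≡_[mod_] : ℕ → ℕ → ℕ → Set
x ≡ y [mod M ] = M ∣ ∣ x - y ∣

_≡?_[mod_] : (x y M : ℕ) → Dec (x ≡ y [mod M ])
x ≡? y [mod M ] = M ∣? ∣ x - y ∣

-- For O_E[G_n] ≅ O_E[Δ][γ]/(γ^{p^{n-1}} - 1) we take A = |Δ| = p - 1 (Δ is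
-- cyclic; σ ∈ Δ is recorded by its exponent w.r.t. a fixed generator δ) and
-- B = p^{n-1} (exponent of γ).  An element Σ_{σ,r} c_{r,σ} σ γ^r is recorded
-- by its coefficient function  c : Fin A → Fin B → R.
module GroupRing {c ℓ : Level} (R : CommutativeRing c ℓ) where
  open CommutativeRing R using (Carrier; _≈_; 0#; 1#)
    renaming (_+_ to _+ᴿ_; _*_ to _*ᴿ_)

  ∑ : (n : ℕ) → (Fin n → Carrier) → Carrier
  ∑ zero    f = 0#
  ∑ (suc n) f = f F.zero +ᴿ ∑ n (λ i → f (F.suc i))

  when : ∀ {a} {P : Set a} → Dec P → Carrier → Carrier
  when (yes _) x = x
  when (no _)  _ = 0#

  El : ℕ → ℕ → Set c
  El A B = Fin A → Fin B → Carrier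

  _⊕_ : ∀ {A B} → El A B → El A B → El A B
  (f ⊕ g) σ r = f σ r +ᴿ g σ r

  _≋_ : ∀ {A B} → El A B → El A B → Set ℓ
  f ≋ g = ∀ σ r → f σ r ≈ g σ r

  mul : ∀ {A B} → El A B → El A B → El A B
  mul {A} {B} f g σ r =
    ∑ A λ σ₁ → ∑ B λ r₁ → ∑ A λ σ₂ → ∑ B λ r₂ →
      when ((toℕ σ₁ + toℕ σ₂) ≡? toℕ σ [mod A ])
        (when ((toℕ r₁ + toℕ r₂) ≡? toℕ r [mod B ]) (f σ₁ r₁ *ᴿ g σ₂ r₂))

  basis : ∀ {A B} → ℕ → ℕ → El A B
  basis {A} {B} i j σ r =
    when (toℕ σ ≡? i [mod A ]) (when (toℕ r ≡? j [mod B ]) 1#)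

  one : ∀ {A B} → El A B
  one = basis 0 0

  γ : ∀ {A B} → El A B
  γ = basis 0 1

  pow : ∀ {A B} → El A B → ℕ → El A B
  pow f zero    = one
  pow f (suc k) = mul f (pow f k)

  Φ : ∀ {A B} → (p m : ℕ) → El A B
  Φ p m σ r = ∑ p λ i → pow γ (toℕ i * p ^ (m ∸ 1)) σ r

  _∣ᴳ_ : ∀ {A B} → El A B → El A B → Set (c Level.⊔ ℓ)
  _∣ᴳ_ {A} {B} d f = Σ[ g ∈ El A B ] (f ≋ mul d g)

  bcoef : (p m n : ℕ) → El (p ∸ 1) (p ^ (n ∸ 1)) →
          Fin (p ∸ 1) → Fin (p ^ m) → Carrier
  bcoef p m n f σ r =
    ∑ (p ^ (n ∸ 1)) λ s → when (toℕ s ≡? toℕ r [mod p ^ m ]) (f σ s)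

-- Write q = p^(m-1), M = p^m = p q and B = p^(n-1), so M ∣ B.  Since
-- Φ_m(γ) = ∑_{i<p} γ^{i q}, multiplying g by Φ_m(γ) acts on every Δ-component
-- g_σ : ℤ/B → R separately, as  D g (s) = ∑_{i<p} g(s - i q)  (mul-Φ).
-- The theorem is thus the description of the image of D (image-D):
--  * (⇒) a fibre sum of D g over a residue class mod M is the fibre sum of g
--    over the class mod q (fibre-D), because each t ≡ r (mod q) has exactly
--    one digit i < p with i q + t ≡ r (mod M) (Digits);
--  * (⇐) if the fibre sums b_r of f are q-periodic, g₀ = b on [0, q) gives
--    D g₀ the same fibre sums, so h = f - D g₀ has vanishing fibre sums; then
--    h = D g₁ for g₁ s = U s - U (s - q), where U s sums h over the t ≤ s with
--    t ≡ s (mod M): D g₁ telescopes to U s - U (s - M) = h s (Integration).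
-- The file first develops arithmetic modulo M and translation in ℤ/n, then
-- finite sums with selectors, the convolution product, the operator D, and
-- finally derives lemma5p1 componentwise from image-D.

module Submission where

open import Defs
open import Level using (Level)
open import Algebra.Bundles using (CommutativeRing)
import Data.Nat as ℕ
open ℕ using (ℕ; zero; suc; NonZero; _∸_; _^_; _≤_; _<_)
open import Data.Nat.Divisibility using () renaming (_∣_ to _ℕ∣_)
open import Data.Fin as F using (Fin; toℕ)
import Data.Fin.Properties as FP
import Relation.Binary.PropositionalEquality as ≡
open ≡ using (_≡_)
open import Data.Product using (Σ-syntax; _×_; _,_; proj₁; proj₂)
open import Data.Nat.Primality using (Prime)
import Data.Nat.Properties as ℕP
open import Function.Bundles using (_⇔_; mk⇔; Equivalence)
open import Relation.Nullary using (Dec; yes; no; ¬_; _×-dec_)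

-- Congruence of natural numbers, as a record so that x, M and y can be
-- inferred from the type (the underlying x ≡ y [mod M] is M ∣ ∣ x - y ∣).
module Congruence where
  open import Data.Nat
  open import Data.Nat.Properties
  open import Data.Nat.DivMod
  open import Data.Nat.Divisibility using (_∣_; divides; ∣-trans)
  open import Data.Sum using (inj₁; inj₂)
  open import Relation.Binary.PropositionalEquality
  open ≡-Reasoning

  infix 4 _≡[_]_
  record _≡[_]_ (x M y : ℕ) : Set where
    constructor mk
    field get : x ≡ y [mod M ]
  open _≡[_]_ public

  mod⇒% : ∀ {x y M} .{{_ : NonZero M}} → x ≡[ M ] y → x % M ≡ y % M
  mod⇒% {x} {y} {M} (mk (divides k eq)) with ≤-total x y
  ... | inj₁ x≤y = sym (begin
      y % M             ≡⟨ cong (_% M) (sym (m+[n∸m]≡n x≤y)) ⟩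
      (x + (y ∸ x)) % M ≡⟨ cong (λ z → (x + z) % M) (trans (sym (m≤n⇒∣m-n∣≡n∸m x≤y)) eq) ⟩
      (x + k * M) % M   ≡⟨ [m+kn]%n≡m%n x k M ⟩
      x % M             ∎)
  ... | inj₂ y≤x = begin
      x % M             ≡⟨ cong (_% M) (sym (m+[n∸m]≡n y≤x)) ⟩
      (y + (x ∸ y)) % M ≡⟨ cong (λ z → (y + z) % M) (trans (sym (m≤n⇒∣m-n∣≡n∸m y≤x)) (trans (∣-∣-comm y x) eq)) ⟩
      (y + k * M) % M   ≡⟨ [m+kn]%n≡m%n y k M ⟩
      y % M             ∎

  %⇒mod : ∀ {x y M} .{{_ : NonZero M}} → x % M ≡ y % M → x ≡[ M ] y
  %⇒mod {x} {y} {M} eq = mk (divides ∣ x / M - y / M ∣ (begin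
    ∣ x - y ∣                                    ≡⟨ cong₂ ∣_-_∣ (m≡m%n+[m/n]*n x M) (m≡m%n+[m/n]*n y M) ⟩
    ∣ x % M + x / M * M - y % M + y / M * M ∣   ≡⟨ cong (λ z → ∣ x % M + x / M * M - z + y / M * M ∣) (sym eq) ⟩
    ∣ x % M + x / M * M - x % M + y / M * M ∣   ≡⟨ ∣m+n-m+o∣≡∣n-o∣ (x % M) _ _ ⟩
    ∣ x / M * M - y / M * M ∣                    ≡⟨ sym (*-distribʳ-∣-∣ M (x / M) (y / M)) ⟩
    ∣ x / M - y / M ∣ * M                        ∎))

  mod-refl : ∀ {x M} → x ≡[ M ] x
  mod-refl {x} = mk (divides 0 (∣n-n∣≡0 x))

  mod-≡ : ∀ {x y M} → x ≡ y → x ≡[ M ] y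
  mod-≡ refl = mod-refl

  mod-sym : ∀ {x y M} → x ≡[ M ] y → y ≡[ M ] x
  mod-sym {x} {y} (mk (divides k eq)) = mk (divides k (trans (∣-∣-comm y x) eq))

  mod-trans : ∀ {x y z M} .{{_ : NonZero M}} → x ≡[ M ] y → y ≡[ M ] z → x ≡[ M ] z
  mod-trans p q = %⇒mod (trans (mod⇒% p) (mod⇒% q))

  mod-weaken : ∀ {x y M d} → d ∣ M → x ≡[ M ] y → x ≡[ d ] y
  mod-weaken d∣M (mk p) = mk (∣-trans d∣M p)

  mod-+ˡ : ∀ z {x y M} → x ≡[ M ] y → z + x ≡[ M ] z + y
  mod-+ˡ z {x} {y} (mk (divides k eq)) = mk (divides k (trans (∣m+n-m+o∣≡∣n-o∣ z x y) eq))

  mod-cancelˡ : ∀ z {x y M} → z + x ≡[ M ] z + y → x ≡[ M ] y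
  mod-cancelˡ z {x} {y} (mk (divides k eq)) = mk (divides k (trans (sym (∣m+n-m+o∣≡∣n-o∣ z x y)) eq))

  mod-+ʳ : ∀ z {x y M} → x ≡[ M ] y → x + z ≡[ M ] y + z
  mod-+ʳ z {x} {y} p rewrite +-comm x z | +-comm y z = mod-+ˡ z p

  mod-cancelʳ : ∀ z {x y M} → x + z ≡[ M ] y + z → x ≡[ M ] y
  mod-cancelʳ z {x} {y} p rewrite +-comm x z | +-comm y z = mod-cancelˡ z p

  mod0⇒∣ : ∀ {x M} → x ≡[ M ] 0 → M ∣ x
  mod0⇒∣ {x} (mk p) = subst (_ ∣_) (∣-∣-identityʳ x) p

  mod-+k* : ∀ x k M → x + k * M ≡[ M ] x
  mod-+k* x k M = mk (divides k (trans (∣-∣-comm (x + k * M) x) (∣m-m+n∣≡n x (k * M))))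

  mod-% : ∀ x M .{{_ : NonZero M}} → x % M ≡[ M ] x
  mod-% x M = %⇒mod (m%n%n≡m%n x M)

  mod-small : ∀ {x y M} .{{_ : NonZero M}} → x < M → y < M → x ≡[ M ] y → x ≡ y
  mod-small x<M y<M p = trans (sym (m<n⇒m%n≡m x<M)) (trans (mod⇒% p) (m<n⇒m%n≡m y<M))

open Congruence

-- Translation in ℤ/n: x ⊖ k is the residue of x - k, i.e. the unique
-- j : Fin n with k + j ≡ x (mod n).  It is the index shift of the group ring.
module Translation where
  open import Data.Nat
  open import Data.Nat.Properties
  open import Data.Nat.DivMod using (_mod_; _%_; m%n<n)
  open import Relation.Binary.PropositionalEquality
  open ≡-Reasoning

  infixl 6 _⊖_
  _⊖_ : ∀ {n} .{{_ : NonZero n}} → ℕ → ℕ → Fin n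
  _⊖_ {n} x k = (x + (n ∸ 1) * k) mod n

  ⊖-spec : ∀ {n} .{{_ : NonZero n}} x k → k + toℕ (_⊖_ {n} x k) ≡[ n ] x
  ⊖-spec {n@(suc n′)} x k = mod-trans (mod-+ˡ k (mod-≡ (FP.toℕ-fromℕ< (m%n<n (x + n′ * k) n))))
    (mod-trans (mod-+ˡ k (mod-% (x + n′ * k) n)) (mod-trans (mod-≡ reassoc) (mod-+k* x k n)))
    where
    reassoc : k + (x + n′ * k) ≡ x + k * n
    reassoc = begin
      k + (x + n′ * k) ≡⟨ +-comm k _ ⟩
      x + n′ * k + k   ≡⟨ +-assoc x _ k ⟩
      x + (n′ * k + k) ≡⟨ cong (x +_) (+-comm (n′ * k) k) ⟩
      x + n * k        ≡⟨ cong (x +_) (*-comm n k) ⟩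
      x + k * n        ∎

  ⊖-solution : ∀ {n} .{{_ : NonZero n}} {x k j} → j < n → k + j ≡[ n ] x → toℕ (_⊖_ {n} x k) ≡ j
  ⊖-solution {n} {x} {k} j<n e = mod-small (FP.toℕ<n (_⊖_ {n} x k)) j<n
    (mod-cancelˡ k (mod-trans (⊖-spec x k) (mod-sym e)))

  ⊖-unique : ∀ {n} .{{_ : NonZero n}} {x k} (j : Fin n) → k + toℕ j ≡[ n ] x → j ≡ x ⊖ k
  ⊖-unique j e = FP.toℕ-injective (sym (⊖-solution (FP.toℕ<n j) e))

  ⊖-identity : ∀ {n} .{{_ : NonZero n}} (j : Fin n) → toℕ j ⊖ 0 ≡ j
  ⊖-identity j = sym (⊖-unique j mod-refl)

  ⊖-congʳ : ∀ {n} .{{_ : NonZero n}} x {k k′} → k ≡[ n ] k′ → _⊖_ {n} x k ≡ x ⊖ k′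
  ⊖-congʳ x {k} e = ⊖-unique (x ⊖ k) (mod-trans (mod-+ʳ _ (mod-sym e)) (⊖-spec x k))

  ⊖-⊖ : ∀ {n} .{{_ : NonZero n}} x k l → toℕ (_⊖_ {n} x k) ⊖ l ≡ x ⊖ (l + k)
  ⊖-⊖ {n} x k l = ⊖-unique _ (mod-trans (mod-≡ shuffle)
      (mod-trans (mod-+ˡ k (⊖-spec (toℕ (_⊖_ {n} x k)) l)) (⊖-spec x k)))
    where
    j : ℕ
    j = toℕ (_⊖_ {n} (toℕ (_⊖_ {n} x k)) l)
    shuffle : l + k + j ≡ k + (l + j)
    shuffle = trans (cong (_+ j) (+-comm l k)) (+-assoc k l j)

  ⊖-below : ∀ {n} .{{_ : NonZero n}} {x k} → k ≤ x → x < n → toℕ (_⊖_ {n} x k) ≡ x ∸ k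
  ⊖-below {x = x} {k} k≤x x<n = ⊖-solution (≤-<-trans (m∸n≤m x k) x<n) (mod-≡ (m+[n∸m]≡n k≤x))

  ⊖-wrap : ∀ {n} .{{_ : NonZero n}} {x k} → x < k → k ≤ n → toℕ (_⊖_ {n} x k) ≡ x + n ∸ k
  ⊖-wrap {n} {x} {k} x<k k≤n = ⊖-solution below (mod-trans (mod-≡ (m+[n∸m]≡n k≤x+n))
      (mod-trans (mod-≡ (cong (x +_) (sym (*-identityˡ n)))) (mod-+k* x 1 n)))
    where
    k≤x+n : k ≤ x + n
    k≤x+n = ≤-trans k≤n (m≤n+m n x)
    below : x + n ∸ k < n
    below = subst (x + n ∸ k <_) (m+n∸m≡n k n) (∸-monoˡ-< (+-monoˡ-< n x<k) k≤x+n)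

open Translation

-- Base-q digits below M = p q: if t ≡ r (mod q) there is exactly one i < p
-- with i q + t ≡ r (mod M).  This is what makes Φ_m(γ) = ∑_{i<p} γ^{i q}
-- turn sums over residues mod M into sums over residues mod q.
module Digits (p q M : ℕ) .{{_ : NonZero q}} .{{_ : NonZero M}} (M≡p*q : M ≡ p ℕ.* q) where
  open import Data.Nat
  open import Data.Nat.Properties
  open import Data.Nat.Divisibility using (_∣_; divides)
  open import Relation.Binary.PropositionalEquality

  q∣M : q ∣ M
  q∣M = divides p M≡p*q

  digit-sound : ∀ i {t r} → i * q + t ≡[ M ] r → t ≡[ q ] r
  digit-sound i {t} e = mod-trans (mod-sym (mod-+k* t i q))
    (mod-trans (mod-≡ (+-comm t (i * q))) (mod-weaken q∣M e))

  digit-unique : ∀ {t r} (i j : Fin p) → toℕ i * q + t ≡[ M ] r → toℕ j * q + t ≡[ M ] r → i ≡ j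
  digit-unique {t} i j ei ej = FP.toℕ-injective (*-cancelʳ-≡ (toℕ i) (toℕ j) q
    (mod-small (digit<M i) (digit<M j) (mod-cancelʳ t (mod-trans ei (mod-sym ej)))))
    where
    digit<M : (i : Fin p) → toℕ i * q < M
    digit<M i = subst (toℕ i * q <_) (sym M≡p*q) (*-monoˡ-< q (FP.toℕ<n i))

  digit-exists : ∀ {t r} → t ≡[ q ] r → Σ[ i ∈ Fin p ] toℕ i * q + t ≡[ M ] r
  digit-exists {t} {r} t≡r = digit-of (mod0⇒∣ d≡0)
    where
    -- d ≡ r - t (mod M) with d < M is a multiple j q of q, and then j < p.
    d : ℕ
    d = toℕ (_⊖_ {M} r t)
    d≡0 : d ≡[ q ] 0
    d≡0 = mod-cancelˡ t (mod-trans (mod-weaken q∣M (⊖-spec r t))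
            (mod-trans (mod-sym t≡r) (mod-≡ (sym (+-identityʳ t)))))
    digit-of : q ∣ d → Σ[ i ∈ Fin p ] toℕ i * q + t ≡[ M ] r
    digit-of (divides j d≡jq) = F.fromℕ< j<p , subst (λ i → i * q + t ≡[ M ] r) (sym (FP.toℕ-fromℕ< j<p))
        (mod-trans (mod-≡ (trans (cong (_+ t) (sym d≡jq)) (+-comm d t))) (⊖-spec r t))
      where
      j<p : j < p
      j<p = *-cancelʳ-< q j p (subst₂ _<_ d≡jq M≡p*q (FP.toℕ<n (_⊖_ {M} r t)))

module ResidueOrder (M : ℕ) .{{_ : NonZero M}} where
  open import Data.Nat
  open import Data.Nat.Properties
  open import Data.Nat.Divisibility using (_∣_; divides)
  open import Data.Empty using (⊥-elim)
  open import Data.Sum using (_⊎_; inj₁; inj₂)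
  open import Relation.Nullary.Decidable using (map′)
  open import Relation.Binary.PropositionalEquality

  infix 4 _≼_
  _≼_ : ℕ → ℕ → Set
  t ≼ s = t ≤ s × t ≡[ M ] s

  _≼?_ : ∀ t s → Dec (t ≼ s)
  t ≼? s = t ≤? s ×-dec map′ mk get (t ≡? s [mod M ])

  mod-gap : ∀ {t s} → t < s → t ≡[ M ] s → t + M ≤ s
  mod-gap {t} {s} t<s (mk (divides zero eq)) = ⊥-elim (<⇒≢ t<s (∣m-n∣≡0⇒m≡n eq))
  mod-gap {t} {s} t<s (mk (divides (suc k) eq)) = begin
    t + M               ≤⟨ +-monoʳ-≤ t (m≤m+n M (k * M)) ⟩
    t + suc k * M       ≡⟨ cong (t +_) (sym eq) ⟩
    t + ∣ t - s ∣       ≡⟨ cong (t +_) (m≤n⇒∣m-n∣≡n∸m (<⇒≤ t<s)) ⟩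
    t + (s ∸ t)         ≡⟨ m+[n∸m]≡n (<⇒≤ t<s) ⟩
    s                   ∎
    where open ≤-Reasoning

  shift-class : ∀ x → x + M ≡[ M ] x
  shift-class x = subst (λ y → x + y ≡[ M ] x) (*-identityˡ M) (mod-+k* x 1 M)

  ≼-step : ∀ {t s X} → X + M ≡ s → t ≼ s → t ≡ s ⊎ t ≼ X
  ≼-step {t} {s} {X} X+M≡s (t≤s , t≡s) with t ≟ s
  ... | yes t≡s′ = inj₁ t≡s′
  ... | no t≢s = inj₂ (+-cancelʳ-≤ M t X (subst (t + M ≤_) (sym X+M≡s) (mod-gap (≤∧≢⇒< t≤s t≢s) t≡s)) ,
                       mod-trans t≡s (mod-trans (mod-≡ (sym X+M≡s)) (shift-class X)))

  ≼-step⁻¹ : ∀ {t s X} → X + M ≡ s → t ≼ X → t ≼ s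
  ≼-step⁻¹ {t} {s} {X} X+M≡s (t≤X , t≡X) = ≤-trans t≤X (subst (X ≤_) X+M≡s (m≤m+n X M)) ,
    mod-trans t≡X (mod-trans (mod-sym (shift-class X)) (mod-≡ X+M≡s))

  ≼-step-disjoint : ∀ {t s X} → X + M ≡ s → t ≡ s → ¬ (t ≼ X)
  ≼-step-disjoint {t} {s} {X} X+M≡s refl (t≤X , _) =
    <⇒≱ (subst (X <_) X+M≡s (m<m+n X (>-nonZero⁻¹ M))) t≤X

  ≼-least : ∀ {t s} → s < M → t ≼ s → t ≡ s
  ≼-least s<M (t≤s , t≡s) = mod-small (≤-<-trans t≤s s<M) s<M t≡s

  module Wrap {B : ℕ} (M∣B : M ∣ B) {s X : ℕ} (X+M≡s+B : X + M ≡ s + B) where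

    X≡s : X ≡[ M ] s
    X≡s = mod-trans (mod-sym (shift-class X)) (mod-trans (mod-≡ X+M≡s+B) (class-of-s M∣B))
      where
      class-of-s : M ∣ B → s + B ≡[ M ] s
      class-of-s (divides K B≡KM) = subst (λ y → s + y ≡[ M ] s) (sym B≡KM) (mod-+k* s K M)

    ≼-wrap : ∀ {t} → t < B → t ≡[ M ] s → t ≼ X
    ≼-wrap {t} t<B t≡s with t ≤? X
    ... | yes t≤X = t≤X , mod-trans t≡s (mod-sym X≡s)
    ... | no t≰X = ⊥-elim (<⇒≱ t<B (begin
      B          ≤⟨ m≤n+m B s ⟩
      s + B      ≡⟨ X+M≡s+B ⟨
      X + M      ≤⟨ mod-gap (≰⇒> t≰X) (mod-trans X≡s (mod-sym t≡s)) ⟩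
      t          ∎))
      where open ≤-Reasoning

    ≼-wrap⁻¹ : ∀ {t} → t ≼ X → t ≡[ M ] s
    ≼-wrap⁻¹ (_ , t≡X) = mod-trans t≡X X≡s

module Powers where
  open import Data.Nat
  open import Data.Nat.Properties
  open import Data.Nat.Divisibility using (_∣_; m∣m*n)
  open import Relation.Binary.PropositionalEquality

  ^-peel : ∀ b {m} → 1 ≤ m → b ^ m ≡ b * b ^ (m ∸ 1)
  ^-peel b {suc m} _ = refl

  ^-∣-^ : ∀ b {i j} → i ≤ j → b ^ i ∣ b ^ j
  ^-∣-^ b {i} {j} i≤j = subst (b ^ i ∣_) exponent-split (m∣m*n (b ^ (j ∸ i)))
    where
    exponent-split : b ^ i * b ^ (j ∸ i) ≡ b ^ j
    exponent-split = trans (sym (^-distribˡ-+-* b i (j ∸ i))) (cong (b ^_) (m+[n∸m]≡n i≤j))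

open Powers

module FiniteSums {c ℓ : Level} (R : CommutativeRing c ℓ) where
  open CommutativeRing R
  open GroupRing R using (∑; when)
  open import Algebra.Properties.Semiring.Sum semiring
    using (sum; sum-cong-≋; ∑-comm; ∑-distrib-+; *-distribˡ-sum; *-distribʳ-sum; sum-replicate-zero)
  open import Algebra.Properties.Ring ring using (-1*x≈-x)
  open import Algebra.Properties.Group +-group using (ε⁻¹≈ε)
  open import Relation.Binary.Reasoning.Setoid setoid
  open import Data.Empty using (⊥; ⊥-elim)
  open import Data.Sum using (_⊎_; [_,_]′)
  open ≡ using (_≢_)

  ∑≈sum : ∀ n (f : Fin n → Carrier) → ∑ n f ≈ sum f
  ∑≈sum n f = reflexive (∑≡sum n f)
    where
    ∑≡sum : ∀ n (f : Fin n → Carrier) → ∑ n f ≡ sum f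
    ∑≡sum zero    f = ≡.refl
    ∑≡sum (suc n) f = ≡.cong (f F.zero +_) (∑≡sum n (λ i → f (F.suc i)))

  ∑-cong : ∀ n {f g : Fin n → Carrier} → (∀ i → f i ≈ g i) → ∑ n f ≈ ∑ n g
  ∑-cong n {f} {g} f≈g = begin
    ∑ n f   ≈⟨ ∑≈sum n f ⟩
    sum f   ≈⟨ sum-cong-≋ f≈g ⟩
    sum g   ≈⟨ ∑≈sum n g ⟨
    ∑ n g   ∎

  ∑-zero : ∀ n → ∑ n (λ _ → 0#) ≈ 0#
  ∑-zero n = trans (∑≈sum n _) (sum-replicate-zero n)

  ∑-+ : ∀ n (f g : Fin n → Carrier) → ∑ n (λ i → f i + g i) ≈ ∑ n f + ∑ n g
  ∑-+ n f g = begin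
    ∑ n (λ i → f i + g i)  ≈⟨ ∑≈sum n _ ⟩
    sum (λ i → f i + g i)  ≈⟨ ∑-distrib-+ f g ⟩
    sum f + sum g          ≈⟨ +-cong (∑≈sum n f) (∑≈sum n g) ⟨
    ∑ n f + ∑ n g          ∎

  ∑-swap : ∀ m n (h : Fin m → Fin n → Carrier) →
    ∑ m (λ i → ∑ n (h i)) ≈ ∑ n (λ j → ∑ m (λ i → h i j))
  ∑-swap m n h = begin
    ∑ m (λ i → ∑ n (h i))               ≈⟨ ∑-cong m (λ i → ∑≈sum n (h i)) ⟩
    ∑ m (λ i → sum (h i))               ≈⟨ ∑≈sum m _ ⟩
    sum (λ i → sum (h i))               ≈⟨ ∑-comm h ⟩
    sum (λ j → sum (λ i → h i j))       ≈⟨ ∑≈sum n _ ⟨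
    ∑ n (λ j → sum (λ i → h i j))       ≈⟨ ∑-cong n (λ j → ∑≈sum m (λ i → h i j)) ⟨
    ∑ n (λ j → ∑ m (λ i → h i j))       ∎

  ∑-*ʳ : ∀ n x (f : Fin n → Carrier) → ∑ n f * x ≈ ∑ n (λ i → f i * x)
  ∑-*ʳ n x f = trans (*-congʳ (∑≈sum n f)) (trans (*-distribʳ-sum x f) (sym (∑≈sum n _)))

  ∑-neg : ∀ n (f : Fin n → Carrier) → - ∑ n f ≈ ∑ n (λ i → - f i)
  ∑-neg n f = begin
    - ∑ n f                     ≈⟨ -1*x≈-x _ ⟨
    - 1# * ∑ n f                ≈⟨ *-congˡ (∑≈sum n f) ⟩
    - 1# * sum f                ≈⟨ *-distribˡ-sum (- 1#) f ⟩
    sum (λ i → - 1# * f i)      ≈⟨ ∑≈sum n _ ⟨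
    ∑ n (λ i → - 1# * f i)      ≈⟨ ∑-cong n (λ i → -1*x≈-x (f i)) ⟩
    ∑ n (λ i → - f i)           ∎

  telescope : ∀ k (a : ℕ → Carrier) → ∑ k (λ i → a (toℕ i) - a (suc (toℕ i))) ≈ a 0 - a k
  telescope zero    a = sym (-‿inverseʳ (a 0))
  telescope (suc k) a = begin
    (a 0 - a 1) + ∑ k (λ i → a (suc (toℕ i)) - a (suc (suc (toℕ i))))
      ≈⟨ +-congˡ (telescope k (λ j → a (suc j))) ⟩
    (a 0 - a 1) + (a 1 - a (suc k))     ≈⟨ +-assoc _ _ _ ⟩
    a 0 + (- a 1 + (a 1 - a (suc k)))   ≈⟨ +-congˡ (+-assoc _ _ _) ⟨
    a 0 + ((- a 1 + a 1) - a (suc k))   ≈⟨ +-congˡ (+-congʳ (-‿inverseˡ _)) ⟩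
    a 0 + (0# - a (suc k))              ≈⟨ +-congˡ (+-identityˡ _) ⟩
    a 0 - a (suc k)                     ∎

  when-yes : ∀ {a} {Q : Set a} (d : Dec Q) x → Q → when d x ≈ x
  when-yes (yes _) x _ = refl
  when-yes (no ¬q) x q = ⊥-elim (¬q q)

  when-no : ∀ {a} {Q : Set a} (d : Dec Q) x → ¬ Q → when d x ≈ 0#
  when-no (yes q) x ¬q = ⊥-elim (¬q q)
  when-no (no _)  x _  = refl

  when-cong : ∀ {a b} {Q : Set a} {Q′ : Set b} (d : Dec Q) (d′ : Dec Q′) {x y} →
    (Q → Q′) → (Q′ → Q) → x ≈ y → when d x ≈ when d′ y
  when-cong (yes _) (yes _)  _  _  x≈y = x≈y
  when-cong (yes q) (no ¬q′) to _  _   = ⊥-elim (¬q′ (to q))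
  when-cong (no ¬q) (yes q′) _ from _  = ⊥-elim (¬q (from q′))
  when-cong (no _)  (no _)   _  _  _   = refl

  when-congʳ : ∀ {a} {Q : Set a} (d : Dec Q) {x y} → x ≈ y → when d x ≈ when d y
  when-congʳ d = when-cong d d (λ q → q) (λ q → q)

  when-*ˡ : ∀ {a} {Q : Set a} (d : Dec Q) x y → when d x * y ≈ when d (x * y)
  when-*ˡ (yes _) x y = refl
  when-*ˡ (no _)  x y = zeroˡ y

  when-+ : ∀ {a} {Q : Set a} (d : Dec Q) x y → when d (x + y) ≈ when d x + when d y
  when-+ (yes _) x y = refl
  when-+ (no _)  x y = sym (+-identityˡ 0#)

  when-neg : ∀ {a} {Q : Set a} (d : Dec Q) x → when d (- x) ≈ - when d x
  when-neg (yes _) x = refl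
  when-neg (no _)  x = sym ε⁻¹≈ε

  when-swap : ∀ {a b} {Q : Set a} {Q′ : Set b} (d : Dec Q) (d′ : Dec Q′) x →
    when d (when d′ x) ≈ when d′ (when d x)
  when-swap (yes _) (yes _) x = refl
  when-swap (yes _) (no _)  x = refl
  when-swap (no _)  (yes _) x = refl
  when-swap (no _)  (no _)  x = refl

  when-× : ∀ {a b} {Q : Set a} {Q′ : Set b} (d : Dec Q) (d′ : Dec Q′) x →
    when (d ×-dec d′) x ≈ when d (when d′ x)
  when-× (yes _) (yes _) x = refl
  when-× (yes _) (no _)  x = refl
  when-× (no _)  _       x = refl

  when-split : ∀ {a b c} {Q : Set a} {Q₁ : Set b} {Q₂ : Set c}
    (d : Dec Q) (d₁ : Dec Q₁) (d₂ : Dec Q₂) x →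
    (Q → Q₁ ⊎ Q₂) → (Q₁ → Q) → (Q₂ → Q) → (Q₁ → Q₂ → ⊥) →
    when d x ≈ when d₁ x + when d₂ x
  when-split (yes _) (yes q₁) (yes q₂) x _ _ _ disjoint = ⊥-elim (disjoint q₁ q₂)
  when-split (yes _) (yes _)  (no _)   x _ _ _ _ = sym (+-identityʳ x)
  when-split (yes _) (no _)   (yes _)  x _ _ _ _ = sym (+-identityˡ x)
  when-split (yes q) (no ¬q₁) (no ¬q₂) x cases _ _ _ =
    ⊥-elim ([ ¬q₁ , ¬q₂ ]′ (cases q))
  when-split (no ¬q) (yes q₁) _        x _ from₁ _ _ = ⊥-elim (¬q (from₁ q₁))
  when-split (no ¬q) (no _)   (yes q₂) x _ _ from₂ _ = ⊥-elim (¬q (from₂ q₂))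
  when-split (no _)  (no _)   (no _)   x _ _ _ _ = sym (+-identityˡ 0#)

  when-mod : ∀ {K} .{{_ : NonZero K}} {x x′ y y′} → x ≡[ K ] x′ → y ≡[ K ] y′ → ∀ {a b} → a ≈ b →
    when (x ≡? y [mod K ]) a ≈ when (x′ ≡? y′ [mod K ]) b
  when-mod {K} {x} {x′} {y} {y′} x≡x′ y≡y′ = when-cong (x ≡? y [mod K ]) (x′ ≡? y′ [mod K ])
    (λ e → get (mod-trans (mod-sym x≡x′) (mod-trans (mk {x} {K} {y} e) y≡y′)))
    (λ e → get (mod-trans x≡x′ (mod-trans (mk {x′} {K} {y′} e) (mod-sym y≡y′))))

  ∑-when : ∀ n {a} {Q : Set a} (d : Dec Q) (f : Fin n → Carrier) →
    ∑ n (λ i → when d (f i)) ≈ when d (∑ n f)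
  ∑-when n (yes _) f = refl
  ∑-when n (no _)  f = ∑-zero n

  ∑-none : ∀ n {a} {Q : Fin n → Set a} (d : ∀ i → Dec (Q i)) (h : Fin n → Carrier) →
    (∀ i → ¬ Q i) → ∑ n (λ i → when (d i) (h i)) ≈ 0#
  ∑-none n d h ¬Q = trans (∑-cong n (λ i → when-no (d i) (h i) (¬Q i))) (∑-zero n)

  ∑-unique : ∀ n {a} {Q : Fin n → Set a} (d : ∀ i → Dec (Q i)) (h : Fin n → Carrier)
    (i₀ : Fin n) → Q i₀ → (∀ i → Q i → i ≡ i₀) → ∑ n (λ i → when (d i) (h i)) ≈ h i₀
  ∑-unique (suc n) d h F.zero q unique = begin
    when (d F.zero) (h F.zero) + ∑ n (λ i → when (d (F.suc i)) (h (F.suc i)))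
      ≈⟨ +-cong (when-yes (d F.zero) _ q)
                (∑-none n (λ i → d (F.suc i)) _ (λ i qi → suc≢zero (unique (F.suc i) qi))) ⟩
    h F.zero + 0#  ≈⟨ +-identityʳ _ ⟩
    h F.zero       ∎
    where
    suc≢zero : ∀ {i : Fin n} → F.suc i ≢ F.zero
    suc≢zero ()
  ∑-unique (suc n) d h (F.suc i₀) q unique = begin
    when (d F.zero) (h F.zero) + ∑ n (λ i → when (d (F.suc i)) (h (F.suc i)))
      ≈⟨ +-cong (when-no (d F.zero) _ (λ q₀ → zero≢suc (unique F.zero q₀)))
                (∑-unique n (λ i → d (F.suc i)) (λ i → h (F.suc i)) i₀ q
                   (λ i qi → FP.suc-injective (unique (F.suc i) qi))) ⟩
    0# + h (F.suc i₀)  ≈⟨ +-identityˡ _ ⟩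
    h (F.suc i₀)       ∎
    where
    zero≢suc : F.zero ≢ F.suc i₀
    zero≢suc ()

  ∑-unique-iff : ∀ n {a b} {Q : Fin n → Set a} {S : Set b} (d : ∀ i → Dec (Q i)) (e : Dec S) x →
    (S → Σ[ i₀ ∈ Fin n ] Q i₀ × (∀ i → Q i → i ≡ i₀)) → (∀ i → Q i → S) →
    ∑ n (λ i → when (d i) x) ≈ when e x
  ∑-unique-iff n d (yes s) x exists _ with exists s
  ... | i₀ , q , unique = ∑-unique n d (λ _ → x) i₀ q unique
  ∑-unique-iff n d (no ¬s) x _ sound = ∑-none n d (λ _ → x) (λ i q → ¬s (sound i q))

  ∑-⊖ : ∀ n .{{_ : NonZero n}} k x (h : Fin n → Carrier) →
    ∑ n (λ j → when (k ℕ.+ toℕ j ≡? x [mod n ]) (h j)) ≈ h (x ⊖ k)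
  ∑-⊖ n k x h = ∑-unique n (λ j → k ℕ.+ toℕ j ≡? x [mod n ]) h (x ⊖ k)
    (get (⊖-spec x k)) (λ j e → ⊖-unique j (mk e))

module Convolution {c ℓ : Level} (R : CommutativeRing c ℓ) where
  open CommutativeRing R
  open GroupRing R
  open FiniteSums R
  open import Relation.Binary.Reasoning.Setoid setoid

  mul-convolution : ∀ {A B} .{{_ : NonZero A}} .{{_ : NonZero B}} (f g : El A B) σ r →
    mul f g σ r ≈ ∑ A (λ σ₁ → ∑ B (λ r₁ → f σ₁ r₁ * g (toℕ σ ⊖ toℕ σ₁) (toℕ r ⊖ toℕ r₁)))
  mul-convolution {A} {B} f g σ r = ∑-cong A (λ σ₁ → ∑-cong B (λ r₁ → begin
    ∑ A (λ σ₂ → ∑ B (λ r₂ → when (σ-cond σ₁ σ₂) (when (r-cond r₁ r₂) (f σ₁ r₁ * g σ₂ r₂))))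
      ≈⟨ ∑-cong A (λ σ₂ → ∑-when B (σ-cond σ₁ σ₂) _) ⟩
    ∑ A (λ σ₂ → when (σ-cond σ₁ σ₂) (∑ B (λ r₂ → when (r-cond r₁ r₂) (f σ₁ r₁ * g σ₂ r₂))))
      ≈⟨ ∑-cong A (λ σ₂ → when-congʳ (σ-cond σ₁ σ₂) (∑-⊖ B (toℕ r₁) (toℕ r) _)) ⟩
    ∑ A (λ σ₂ → when (σ-cond σ₁ σ₂) (f σ₁ r₁ * g σ₂ (toℕ r ⊖ toℕ r₁)))
      ≈⟨ ∑-⊖ A (toℕ σ₁) (toℕ σ) _ ⟩
    f σ₁ r₁ * g (toℕ σ ⊖ toℕ σ₁) (toℕ r ⊖ toℕ r₁) ∎))
    where
    σ-cond : (σ₁ σ₂ : Fin A) → Dec (toℕ σ₁ ℕ.+ toℕ σ₂ ≡ toℕ σ [mod A ])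
    σ-cond σ₁ σ₂ = toℕ σ₁ ℕ.+ toℕ σ₂ ≡? toℕ σ [mod A ]
    r-cond : (r₁ r₂ : Fin B) → Dec (toℕ r₁ ℕ.+ toℕ r₂ ≡ toℕ r [mod B ])
    r-cond r₁ r₂ = toℕ r₁ ℕ.+ toℕ r₂ ≡? toℕ r [mod B ]

  -- Multiplication by γ^k translates the γ-index by k.  (The conditions
  -- t ≡ i (mod n) of basis are the conditions 0 + t ≡ i (mod n) of ∑-⊖.)
  mul-translate : ∀ {A B} .{{_ : NonZero A}} .{{_ : NonZero B}} k (g : El A B) σ r →
    mul (basis 0 k) g σ r ≈ g σ (toℕ r ⊖ k)
  mul-translate {A} {B} k g σ r = begin
    mul (basis 0 k) g σ r
      ≈⟨ mul-convolution _ g σ r ⟩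
    ∑ A (λ σ₁ → ∑ B (λ r₁ → when (at0 σ₁) (when (atk r₁) 1#) * G σ₁ r₁))
      ≈⟨ ∑-cong A (λ σ₁ → ∑-cong B (λ r₁ → when-unit-* (at0 σ₁) (atk r₁) _)) ⟩
    ∑ A (λ σ₁ → ∑ B (λ r₁ → when (at0 σ₁) (when (atk r₁) (G σ₁ r₁))))
      ≈⟨ ∑-cong A (λ σ₁ → trans (∑-when B (at0 σ₁) _) (when-congʳ (at0 σ₁) (∑-⊖ B 0 k _))) ⟩
    ∑ A (λ σ₁ → when (at0 σ₁) (G σ₁ (k ⊖ 0)))
      ≈⟨ ∑-⊖ A 0 0 _ ⟩
    g (toℕ σ ⊖ toℕ (0 ⊖ 0)) (toℕ r ⊖ toℕ (k ⊖ 0))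
      ≡⟨ ≡.cong₂ g (≡.trans (⊖-congʳ (toℕ σ) (⊖-spec 0 0)) (⊖-identity σ))
                   (⊖-congʳ (toℕ r) (⊖-spec k 0)) ⟩
    g σ (toℕ r ⊖ k) ∎
    where
    at0 : (σ₁ : Fin A) → Dec (toℕ σ₁ ≡ 0 [mod A ])
    at0 σ₁ = toℕ σ₁ ≡? 0 [mod A ]
    atk : (r₁ : Fin B) → Dec (toℕ r₁ ≡ k [mod B ])
    atk r₁ = toℕ r₁ ≡? k [mod B ]
    G : Fin A → Fin B → Carrier
    G σ₁ r₁ = g (toℕ σ ⊖ toℕ σ₁) (toℕ r ⊖ toℕ r₁)
    when-unit-* : ∀ {a b} {Q : Set a} {Q′ : Set b} (d : Dec Q) (d′ : Dec Q′) y →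
      when d (when d′ 1#) * y ≈ when d (when d′ y)
    when-unit-* d d′ y = trans (when-*ˡ d _ y)
      (when-congʳ d (trans (when-*ˡ d′ 1# y) (when-congʳ d′ (*-identityˡ y))))

  pow-γ : ∀ {A B} .{{_ : NonZero A}} .{{_ : NonZero B}} k → pow {A} {B} γ k ≋ basis 0 k
  pow-γ zero σ r = refl
  pow-γ {A} {B} (suc k) σ r = begin
    mul γ (pow γ k) σ r       ≈⟨ mul-translate 1 (pow γ k) σ r ⟩
    pow γ k σ (toℕ r ⊖ 1)     ≈⟨ pow-γ k σ _ ⟩
    basis 0 k σ (toℕ r ⊖ 1)   ≈⟨ when-congʳ (toℕ σ ≡? 0 [mod A ])
                                   (when-cong (toℕ (_⊖_ {B} (toℕ r) 1) ≡? k [mod B ]) (toℕ r ≡? suc k [mod B ])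
                                              shifted unshifted refl) ⟩
    basis 0 (suc k) σ r       ∎
    where
    shifted : toℕ (_⊖_ {B} (toℕ r) 1) ≡ k [mod B ] → toℕ r ≡ suc k [mod B ]
    shifted e = get (mod-trans (mod-sym (⊖-spec (toℕ r) 1)) (mod-+ˡ 1 (mk e)))
    unshifted : toℕ r ≡ suc k [mod B ] → toℕ (_⊖_ {B} (toℕ r) 1) ≡ k [mod B ]
    unshifted e = get (mod-cancelˡ 1 (mod-trans (⊖-spec (toℕ r) 1) (mk e)))

  mul-linearˡ : ∀ {A B} .{{_ : NonZero A}} .{{_ : NonZero B}} n (f : El A B) (fs : Fin n → El A B) (g : El A B) →
    (∀ σ r → f σ r ≈ ∑ n (λ i → fs i σ r)) → ∀ σ r → mul f g σ r ≈ ∑ n (λ i → mul (fs i) g σ r)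
  mul-linearˡ {A} {B} n f fs g f≈∑fs σ r = begin
    mul f g σ r
      ≈⟨ mul-convolution f g σ r ⟩
    ∑ A (λ σ₁ → ∑ B (λ r₁ → f σ₁ r₁ * G σ₁ r₁))
      ≈⟨ ∑-cong A (λ σ₁ → ∑-cong B (λ r₁ → trans (*-congʳ (f≈∑fs σ₁ r₁)) (∑-*ʳ n _ _))) ⟩
    ∑ A (λ σ₁ → ∑ B (λ r₁ → ∑ n (λ i → fs i σ₁ r₁ * G σ₁ r₁)))
      ≈⟨ ∑-cong A (λ σ₁ → ∑-swap B n _) ⟩
    ∑ A (λ σ₁ → ∑ n (λ i → ∑ B (λ r₁ → fs i σ₁ r₁ * G σ₁ r₁)))
      ≈⟨ ∑-swap A n _ ⟩
    ∑ n (λ i → ∑ A (λ σ₁ → ∑ B (λ r₁ → fs i σ₁ r₁ * G σ₁ r₁)))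
      ≈⟨ ∑-cong n (λ i → mul-convolution (fs i) g σ r) ⟨
    ∑ n (λ i → mul (fs i) g σ r) ∎
    where
    G : Fin A → Fin B → Carrier
    G σ₁ r₁ = g (toℕ σ ⊖ toℕ σ₁) (toℕ r ⊖ toℕ r₁)

  mul-Φ : ∀ {A B} .{{_ : NonZero A}} .{{_ : NonZero B}} p m (g : El A B) σ r →
    mul (Φ p m) g σ r ≈ ∑ p (λ i → g σ (toℕ r ⊖ toℕ i ℕ.* p ^ (m ∸ 1)))
  mul-Φ p m g σ r = trans
    (mul-linearˡ p (Φ p m) (λ i → basis 0 (toℕ i ℕ.* p ^ (m ∸ 1))) g
      (λ σ′ r′ → ∑-cong p (λ i → pow-γ _ σ′ r′)) σ r)
    (∑-cong p (λ i → mul-translate _ g σ r))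

module PhiOperator {c ℓ : Level} (R : CommutativeRing c ℓ)
  (p q M B : ℕ) .{{_ : NonZero q}} .{{_ : NonZero M}} .{{_ : NonZero B}}
  (M≡p*q : M ≡ p ℕ.* q) (M∣B : M ℕ∣ B) where
  open CommutativeRing R
  open GroupRing R using (∑; when)
  open FiniteSums R
  open Digits p q M M≡p*q
  open import Algebra.Properties.Group +-group using (ε⁻¹≈ε; //-rightDividesˡ; //-rightDividesʳ)
  open import Relation.Binary.Reasoning.Setoid setoid
  open import Data.Nat.Divisibility using (∣⇒≤; ∣-trans)

  D : (Fin B → Carrier) → Fin B → Carrier
  D g s = ∑ p (λ i → g (toℕ s ⊖ toℕ i ℕ.* q))

  fibre : ℕ → (Fin B → Carrier) → ℕ → Carrier
  fibre K f r = ∑ B (λ s → when (toℕ s ≡? r [mod K ]) (f s))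

  fibre-cong : ∀ K .{{_ : NonZero K}} {f g : Fin B → Carrier} {r r′} →
    (∀ s → f s ≈ g s) → r ≡[ K ] r′ → fibre K f r ≈ fibre K g r′
  fibre-cong K f≈g r≡r′ = ∑-cong B (λ s → when-mod (mod-refl {toℕ s}) r≡r′ (f≈g s))

  fibre-difference : ∀ K (f g : Fin B → Carrier) r →
    fibre K (λ s → f s - g s) r ≈ fibre K f r - fibre K g r
  fibre-difference K f g r = begin
    ∑ B (λ s → when (inK s) (f s - g s))
      ≈⟨ ∑-cong B (λ s → trans (when-+ (inK s) _ _) (+-congˡ (when-neg (inK s) _))) ⟩
    ∑ B (λ s → when (inK s) (f s) - when (inK s) (g s))
      ≈⟨ ∑-+ B _ _ ⟩
    fibre K f r + ∑ B (λ s → - when (inK s) (g s))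
      ≈⟨ +-congˡ (∑-neg B _) ⟨
    fibre K f r - fibre K g r ∎
    where
    inK : (s : Fin B) → Dec (toℕ s ≡ r [mod K ])
    inK s = toℕ s ≡? r [mod K ]

  D-+ : ∀ (g g′ : Fin B → Carrier) s → D (λ t → g t + g′ t) s ≈ D g s + D g′ s
  D-+ g g′ s = ∑-+ p _ _

  fibre-translate : ∀ k (G : Fin B → Carrier) r →
    fibre M (λ s → G (toℕ s ⊖ k)) r ≈ ∑ B (λ t → when (k ℕ.+ toℕ t ≡? r [mod M ]) (G t))
  fibre-translate k G r = begin
    ∑ B (λ s → when (inM s) (G (toℕ s ⊖ k)))
      ≈⟨ ∑-cong B (λ s → when-congʳ (inM s) (∑-⊖ B k (toℕ s) G)) ⟨
    ∑ B (λ s → when (inM s) (∑ B (λ t → when (hits t s) (G t))))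
      ≈⟨ ∑-cong B (λ s → ∑-when B (inM s) _) ⟨
    ∑ B (λ s → ∑ B (λ t → when (inM s) (when (hits t s) (G t))))
      ≈⟨ ∑-swap B B _ ⟩
    ∑ B (λ t → ∑ B (λ s → when (inM s) (when (hits t s) (G t))))
      ≈⟨ ∑-cong B (λ t → ∑-cong B (λ s → when-swap (inM s) (hits t s) _)) ⟩
    ∑ B (λ t → ∑ B (λ s → when (hits t s) (when (inM s) (G t))))
      ≈⟨ ∑-cong B (λ t → ∑-unique B (hits t) _ (hit t) (get (mod-sym (⊖-spec (k ℕ.+ toℕ t) 0)))
                            (λ s e → ⊖-unique s (mod-sym (mk {k ℕ.+ toℕ t} {B} {toℕ s} e)))) ⟩
    ∑ B (λ t → when (inM (hit t)) (G t))
      ≈⟨ ∑-cong B (λ t → when-mod (hit-class t) (mod-refl {r}) refl) ⟩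
    ∑ B (λ t → when (k ℕ.+ toℕ t ≡? r [mod M ]) (G t)) ∎
    where
    inM : (s : Fin B) → Dec (toℕ s ≡ r [mod M ])
    inM s = toℕ s ≡? r [mod M ]
    hits : (t s : Fin B) → Dec (k ℕ.+ toℕ t ≡ toℕ s [mod B ])
    hits t s = k ℕ.+ toℕ t ≡? toℕ s [mod B ]
    hit : Fin B → Fin B
    hit t = (k ℕ.+ toℕ t) ⊖ 0
    hit-class : ∀ t → toℕ (hit t) ≡[ M ] k ℕ.+ toℕ t
    hit-class t = mod-weaken M∣B (⊖-spec (k ℕ.+ toℕ t) 0)

  fibre-D : ∀ (g : Fin B → Carrier) r → fibre M (D g) r ≈ fibre q g r
  fibre-D g r = begin
    ∑ B (λ s → when (inM s) (∑ p (λ i → g (toℕ s ⊖ toℕ i ℕ.* q))))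
      ≈⟨ ∑-cong B (λ s → ∑-when p (inM s) _) ⟨
    ∑ B (λ s → ∑ p (λ i → when (inM s) (g (toℕ s ⊖ toℕ i ℕ.* q))))
      ≈⟨ ∑-swap B p _ ⟩
    ∑ p (λ i → fibre M (λ s → g (toℕ s ⊖ toℕ i ℕ.* q)) r)
      ≈⟨ ∑-cong p (λ i → fibre-translate (toℕ i ℕ.* q) g r) ⟩
    ∑ p (λ i → ∑ B (λ t → when (digit i t) (g t)))
      ≈⟨ ∑-swap p B _ ⟩
    ∑ B (λ t → ∑ p (λ i → when (digit i t) (g t)))
      ≈⟨ ∑-cong B (λ t → ∑-unique-iff p (λ i → digit i t) (toℕ t ≡? r [mod q ]) (g t)
           (λ e → let (i , ei) = digit-exists {toℕ t} {r} (mk e) in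
                  i , get ei , λ j ej → digit-unique j i (mk ej) ei)
           (λ i e → get (digit-sound (toℕ i) {toℕ t} {r} (mk e)))) ⟩
    fibre q g r ∎
    where
    inM : (s : Fin B) → Dec (toℕ s ≡ r [mod M ])
    inM s = toℕ s ≡? r [mod M ]
    digit : (i : Fin p) (t : Fin B) → Dec (toℕ i ℕ.* q ℕ.+ toℕ t ≡ r [mod M ])
    digit i t = toℕ i ℕ.* q ℕ.+ toℕ t ≡? r [mod M ]

  -- If all fibre sums of h modulo M vanish, then h = D g₁, where
  --   U s = ∑_{t ≼ s} h t  (partial fibre sums)  and  g₁ s = U s - U (s - q):
  -- D g₁ telescopes to U s - U (s - M), which is h s.
  module Integration (h : Fin B → Carrier) (fibres-vanish : ∀ r → fibre M h r ≈ 0#) where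
    open ResidueOrder M

    U : Fin B → Carrier
    U s = ∑ B (λ t → when (toℕ t ≼? toℕ s) (h t))

    g₁ : Fin B → Carrier
    g₁ s = U s - U (toℕ s ⊖ q)

    U-step : ∀ s → U s - U (toℕ s ⊖ M) ≈ h s
    U-step s with M ℕ.≤? toℕ s
    ... | yes M≤s = begin
      U s - U X
        ≈⟨ +-congʳ (∑-cong B (λ t → when-split (toℕ t ≼? toℕ s) (toℕ t ℕ.≟ toℕ s) (toℕ t ≼? toℕ X) (h t)
             (≼-step X+M≡s) (λ t≡s → ℕP.≤-reflexive t≡s , mod-≡ t≡s) (≼-step⁻¹ X+M≡s) (≼-step-disjoint X+M≡s))) ⟩
      ∑ B (λ t → when (toℕ t ℕ.≟ toℕ s) (h t) + when (toℕ t ≼? toℕ X) (h t)) - U X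
        ≈⟨ +-congʳ (∑-+ B _ _) ⟩
      (∑ B (λ t → when (toℕ t ℕ.≟ toℕ s) (h t)) + U X) - U X
        ≈⟨ //-rightDividesʳ (U X) _ ⟩
      ∑ B (λ t → when (toℕ t ℕ.≟ toℕ s) (h t))
        ≈⟨ ∑-unique B (λ t → toℕ t ℕ.≟ toℕ s) h s ≡.refl (λ t → FP.toℕ-injective) ⟩
      h s ∎
      where
      X : Fin B
      X = toℕ s ⊖ M
      X+M≡s : toℕ X ℕ.+ M ≡ toℕ s
      X+M≡s = ≡.trans (≡.cong (ℕ._+ M) (⊖-below M≤s (FP.toℕ<n s))) (ℕP.m∸n+n≡m M≤s)
    ... | no M≰s = begin
      U s - U X
        ≈⟨ +-cong (∑-unique B (λ t → toℕ t ≼? toℕ s) h s (ℕP.≤-refl , mod-refl) (λ t t≼s → FP.toℕ-injective (≼-least s<M t≼s)))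
                  (-‿cong (trans (∑-cong B λ t → when-cong (toℕ t ≼? toℕ X) (toℕ t ≡? toℕ s [mod M ])
                                                     (λ t≼X → get (≼-wrap⁻¹ t≼X))
                                                     (λ e → ≼-wrap (FP.toℕ<n t) (mk e)) refl)
                                 (fibres-vanish (toℕ s)))) ⟩
      h s - 0#  ≈⟨ +-congˡ ε⁻¹≈ε ⟩
      h s + 0#  ≈⟨ +-identityʳ (h s) ⟩
      h s ∎
      where
      s<M : toℕ s < M
      s<M = ℕP.≰⇒> M≰s
      X : Fin B
      X = toℕ s ⊖ M
      M≤B : M ≤ B
      M≤B = ∣⇒≤ M∣B
      X+M≡s+B : toℕ X ℕ.+ M ≡ toℕ s ℕ.+ B
      X+M≡s+B = ≡.trans (≡.cong (ℕ._+ M) (⊖-wrap s<M M≤B)) (ℕP.m∸n+n≡m (ℕP.≤-trans M≤B (ℕP.m≤n+m B (toℕ s))))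
      open Wrap M∣B X+M≡s+B

    D-g₁ : ∀ s → D g₁ s ≈ h s
    D-g₁ s = begin
      ∑ p (λ i → U (toℕ s ⊖ toℕ i ℕ.* q) - U (toℕ (toℕ s ⊖ toℕ i ℕ.* q) ⊖ q))
        ≈⟨ ∑-cong p (λ i → +-congˡ (-‿cong (reflexive (≡.cong U (⊖-⊖ (toℕ s) (toℕ i ℕ.* q) q))))) ⟩
      ∑ p (λ i → a (toℕ i) - a (suc (toℕ i)))
        ≈⟨ telescope p a ⟩
      a 0 - a p
        ≡⟨ ≡.cong₂ (λ x y → U x - U y) (⊖-identity s) (≡.cong (toℕ s ⊖_) (≡.sym M≡p*q)) ⟩
      U s - U (toℕ s ⊖ M)
        ≈⟨ U-step s ⟩
      h s ∎
      where
      a : ℕ → Carrier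
      a j = U (toℕ s ⊖ j ℕ.* q)

  -- If the fibre sums of f modulo M depend only on the residue modulo q,
  -- then f = D (g₀ + g₁): g₀ (supported on [0, q)) matches all fibre sums,
  -- and the remainder f - D g₀ has vanishing fibre sums, so Integration applies.
  module Preimage (f : Fin B → Carrier)
    (fibres-mod-q : ∀ (r s : Fin M) → toℕ r ≡ toℕ s [mod q ] → fibre M f (toℕ r) ≈ fibre M f (toℕ s)) where

    fibre-periodic : ∀ {x y} → x ≡[ q ] y → fibre M f x ≈ fibre M f y
    fibre-periodic {x} {y} x≡y = begin
      fibre M f x                    ≈⟨ fibre-cong M (λ _ → refl) (mod-sym (⊖-spec x 0)) ⟩
      fibre M f (toℕ (_⊖_ {M} x 0))  ≈⟨ fibres-mod-q (x ⊖ 0) (y ⊖ 0) (get reduced) ⟩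
      fibre M f (toℕ (_⊖_ {M} y 0))  ≈⟨ fibre-cong M (λ _ → refl) (⊖-spec y 0) ⟩
      fibre M f y                    ∎
      where
      reduced : toℕ (_⊖_ {M} x 0) ≡[ q ] toℕ (_⊖_ {M} y 0)
      reduced = mod-trans (mod-weaken q∣M (⊖-spec x 0))
                  (mod-trans x≡y (mod-sym (mod-weaken q∣M (⊖-spec y 0))))

    g₀ : Fin B → Carrier
    g₀ t = when (toℕ t ℕ.<? q) (fibre M f (toℕ t))

    fibre-g₀ : ∀ r → fibre q g₀ r ≈ fibre M f r
    fibre-g₀ r = begin
      ∑ B (λ t → when (inq t) (when (below t) (fibre M f (toℕ t))))
        ≈⟨ ∑-cong B (λ t → when-× (inq t) (below t) _) ⟨
      ∑ B (λ t → when (inq t ×-dec below t) (fibre M f (toℕ t)))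
        ≈⟨ ∑-unique B (λ t → inq t ×-dec below t) _ t₀ (get t₀≡r , t₀<q)
             (λ t (t≡r , t<q) → FP.toℕ-injective (mod-small t<q t₀<q (mod-trans (mk t≡r) (mod-sym t₀≡r)))) ⟩
      fibre M f (toℕ t₀)
        ≈⟨ fibre-periodic t₀≡r ⟩
      fibre M f r ∎
      where
      inq : (t : Fin B) → Dec (toℕ t ≡ r [mod q ])
      inq t = toℕ t ≡? r [mod q ]
      below : (t : Fin B) → Dec (toℕ t < q)
      below t = toℕ t ℕ.<? q
      q≤B : q ≤ B
      q≤B = ∣⇒≤ (∣-trans q∣M M∣B)
      t₀ : Fin B
      t₀ = F.inject≤ (_⊖_ {q} r 0) q≤B
      t₀≡r : toℕ t₀ ≡[ q ] r
      t₀≡r = ≡.subst (_≡[ q ] r) (≡.sym (FP.toℕ-inject≤ (_⊖_ {q} r 0) q≤B)) (⊖-spec r 0)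
      t₀<q : toℕ t₀ < q
      t₀<q = ≡.subst (_< q) (≡.sym (FP.toℕ-inject≤ (_⊖_ {q} r 0) q≤B)) (FP.toℕ<n (_⊖_ {q} r 0))

    h : Fin B → Carrier
    h s = f s - D g₀ s

    fibres-h : ∀ r → fibre M h r ≈ 0#
    fibres-h r = begin
      fibre M h r                          ≈⟨ fibre-difference M f (D g₀) r ⟩
      fibre M f r - fibre M (D g₀) r       ≈⟨ +-congˡ (-‿cong (trans (fibre-D g₀ r) (fibre-g₀ r))) ⟩
      fibre M f r - fibre M f r            ≈⟨ -‿inverseʳ _ ⟩
      0#                                   ∎

    open Integration h fibres-h

    preimage : Fin B → Carrier
    preimage s = g₀ s + g₁ s

    D-preimage : ∀ s → f s ≈ D preimage s
    D-preimage s = sym (begin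
      D preimage s              ≈⟨ D-+ g₀ g₁ s ⟩
      D g₀ s + D g₁ s           ≈⟨ +-congˡ (D-g₁ s) ⟩
      D g₀ s + (f s - D g₀ s)   ≈⟨ +-comm _ _ ⟩
      (f s - D g₀ s) + D g₀ s   ≈⟨ //-rightDividesˡ (D g₀ s) (f s) ⟩
      f s                       ∎)

  fibres-of-image : ∀ (f g : Fin B → Carrier) → (∀ s → f s ≈ D g s) →
    ∀ (r s : Fin M) → toℕ r ≡ toℕ s [mod q ] → fibre M f (toℕ r) ≈ fibre M f (toℕ s)
  fibres-of-image f g f≈Dg r s r≡s = begin
    fibre M f (toℕ r)      ≈⟨ fibre-cong M f≈Dg mod-refl ⟩
    fibre M (D g) (toℕ r)  ≈⟨ fibre-D g (toℕ r) ⟩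
    fibre q g (toℕ r)      ≈⟨ fibre-cong q (λ _ → refl) (mk r≡s) ⟩
    fibre q g (toℕ s)      ≈⟨ fibre-D g (toℕ s) ⟨
    fibre M (D g) (toℕ s)  ≈⟨ fibre-cong M f≈Dg mod-refl ⟨
    fibre M f (toℕ s)      ∎

  image-D : ∀ (f : Fin B → Carrier) →
    (Σ[ g ∈ (Fin B → Carrier) ] (∀ s → f s ≈ D g s)) ⇔
    (∀ (r s : Fin M) → toℕ r ≡ toℕ s [mod q ] → fibre M f (toℕ r) ≈ fibre M f (toℕ s))
  image-D f = mk⇔ (λ (g , f≈Dg) → fibres-of-image f g f≈Dg)
                  (λ periodic → Preimage.preimage f periodic , Preimage.D-preimage f periodic)

-- The theorem, componentwise in σ ∈ Δ: with q = p^(m-1), M = p^m and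
-- B = p^(n-1), the σ-component of Φ_m(γ) g is D g_σ (mul-Φ) and
-- bcoef p m n f σ r is the fibre sum fibre M (f σ) r, so image-D applies.
lemma5p1 : {c ℓ : Level} (R : CommutativeRing c ℓ) →
    let open GroupRing R in
    (p : ℕ) → Prime p → 3 ≤ p → (m n : ℕ) → 1 ≤ m → m < n →
    (f : El (p ∸ 1) (p ^ (n ∸ 1))) →
    (Φ p m ∣ᴳ f) ⇔
    (∀ (σ : Fin (p ∸ 1)) (r s : Fin (p ^ m)) →
    toℕ r ≡ toℕ s [mod p ^ (m ∸ 1) ] →
    CommutativeRing._≈_ R (bcoef p m n f σ r) (bcoef p m n f σ s))
lemma5p1 {ℓ = ℓ} R p _ 3≤p m n 1≤m m<n f = mk⇔ divisible⇒periodic periodic⇒divisible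
  where
  open CommutativeRing R using (Carrier; _≈_; trans; sym)
  open GroupRing R using (Φ; _∣ᴳ_; bcoef)
  open Convolution R using (mul-Φ)
  -- p ≥ 3 makes all moduli nonzero.
  instance
    p≢0 : NonZero p
    p≢0 = ℕ.>-nonZero (ℕP.≤-trans (ℕ.s≤s ℕ.z≤n) 3≤p)
    p-1≢0 : NonZero (p ∸ 1)
    p-1≢0 = ℕ.>-nonZero (ℕP.<⇒≤pred (ℕP.≤-trans (ℕ.s≤s (ℕ.s≤s ℕ.z≤n)) 3≤p))
    q≢0 : NonZero (p ^ (m ∸ 1))
    q≢0 = ℕP.m^n≢0 p (m ∸ 1)
    M≢0 : NonZero (p ^ m)
    M≢0 = ℕP.m^n≢0 p m
    B≢0 : NonZero (p ^ (n ∸ 1))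
    B≢0 = ℕP.m^n≢0 p (n ∸ 1)
  open PhiOperator R p (p ^ (m ∸ 1)) (p ^ m) (p ^ (n ∸ 1)) (^-peel p 1≤m) (^-∣-^ p (ℕP.<⇒≤pred m<n))
    using (D; image-D)

  Periodic : Set ℓ
  Periodic = ∀ (σ : Fin (p ∸ 1)) (r s : Fin (p ^ m)) →
    toℕ r ≡ toℕ s [mod p ^ (m ∸ 1) ] → bcoef p m n f σ r ≈ bcoef p m n f σ s

  divisible⇒periodic : Φ p m ∣ᴳ f → Periodic
  divisible⇒periodic (g , f≈Φg) σ =
    Equivalence.to (image-D (f σ)) (g σ , λ s → trans (f≈Φg σ s) (mul-Φ p m g σ s))

  periodic⇒divisible : Periodic → Φ p m ∣ᴳ f
  periodic⇒divisible periodic =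
    (λ σ → proj₁ (component σ)) , (λ σ s → trans (proj₂ (component σ) s) (sym (mul-Φ p m _ σ s)))
    where
    component : ∀ σ → Σ[ g ∈ (Fin (p ^ (n ∸ 1)) → Carrier) ] (∀ s → f σ s ≈ D g s)
    component σ = Equivalence.from (image-D (f σ)) (periodic σ)
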